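{- Let $G'$ be an identifiable graph, $v$ a vertex of $G'$, $S$ a $\Delta$-star with $\Delta\ge 3$, and $G=G'\rhd_v S$. Then $G$ is identifiable and $\gamma^{\rm ID}(G)\le\gamma^{\rm ID}(G')+\Delta-1$.
   Context: A graph is identifiable if no two distinct vertices have the same closed neighborhood $N[\cdot]$. An identifying code of a graph $G$ is a set $C\subseteq V(G)$ such that every vertex $v$ satisfies $N[v]\cap C\neq\emptyset$ and distinct vertices $u,v$ satisfy $N[u]\cap C\neq N[v]\cap C$; $\gamma^{\rm ID}(G)$ is the minimum size of an identifying code of an identifiable graph. A $\Delta$-star is $K_{1,\Delta}$. $G'\rhd_v S$ denotes the graph obtained from the disjoint union of $G'$ and $S$ by identifying $v$ with a leaf of $S$. -}

module Defs where

open import Data.Nat using (ℕ; _+_; _≤_)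
open import Data.Fin using (Fin; zero; suc; splitAt; _≟_)
open import Data.Fin.Subset using (Subset; _∈_; ∣_∣)
open import Data.Bool using (Bool; true; false; T)
open import Data.Sum using (_⊎_; inj₁; inj₂)
open import Data.Product using (_×_; ∃; ∃-syntax)
open import Relation.Nullary using (¬_; ⌊_⌋)
open import Relation.Binary.PropositionalEquality using (_≡_; _≢_)
open import Function.Bundles using (_⇔_)

record Graph : Set where
  constructor mkGraph
  field
    n   : ℕ
    adj : Fin n → Fin n → Bool
open Graph public

record IsSimple (G : Graph) : Set where
  field
    adj-sym    : ∀ u w → adj G u w ≡ adj G w u
    adj-irrefl : ∀ u → adj G u u ≡ false

_∈N[_] : {G : Graph} → Fin (n G) → Fin (n G) → Set
_∈N[_] {G} w u = (w ≡ u) ⊎ T (adj G u w)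

Identifiable : Graph → Set
Identifiable G = ∀ (u w : Fin (n G)) → u ≢ w →
  ¬ (∀ x → (_∈N[_] {G} x u) ⇔ (_∈N[_] {G} x w))

IsIDCode : (G : Graph) → Subset (n G) → Set
IsIDCode G C =
  (∀ (v : Fin (n G)) → ∃[ x ] (x ∈ C × _∈N[_] {G} x v)) ×
  (∀ (u w : Fin (n G)) → u ≢ w →
     ¬ (∀ x → x ∈ C → (_∈N[_] {G} x u) ⇔ (_∈N[_] {G} x w)))

IsGammaID : Graph → ℕ → Set
IsGammaID G k =
  (∃[ C ] (IsIDCode G C × ∣ C ∣ ≡ k)) ×
  (∀ C → IsIDCode G C → k ≤ ∣ C ∣)

-- G' ▷_v S for S = K_{1,Δ}: new vertices are Fin Δ (appended after the
-- n vertices of G'); index zero is the centre of the star, indices suc i are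
-- the Δ-1 remaining leaves; the Δ-th leaf of S is identified with v.
starAdj : (m : ℕ) (v : Fin m) (Δ : ℕ) → Fin m ⊎ Fin Δ → Fin m ⊎ Fin Δ →
          (Fin m → Fin m → Bool) → Bool
starAdj m v Δ (inj₁ a)       (inj₁ b)       A = A a b
starAdj m v Δ (inj₁ a)       (inj₂ zero)    A = ⌊ a ≟ v ⌋
starAdj m v Δ (inj₂ zero)    (inj₁ b)       A = ⌊ b ≟ v ⌋
starAdj m v Δ (inj₂ zero)    (inj₂ (suc _)) A = true
starAdj m v Δ (inj₂ (suc _)) (inj₂ zero)    A = true
starAdj m v Δ _              _              A = false

attachStar : (G' : Graph) → Fin (n G') → ℕ → Graph
attachStar G' v Δ = mkGraph (n G' + Δ)
  (λ x y → starAdj (n G') v Δ (splitAt (n G') x) (splitAt (n G') y) (adj G'))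

{-# OPTIONS --safe #-}
-- Extend an identifying code C' of G' by the Δ − 1 new leaves of the star.  Each new vertex
-- is then told apart from every other vertex by a leaf in the code: a leaf lies in its own
-- neighbourhood, in the centre's, and in no old vertex's, and a centre and a leaf differ on a
-- second leaf.  Old vertices see no new leaf, and G' is an induced subgraph of G, so C'
-- still separates them.  Taking C' = V(G') shows G is identifiable; since being an
-- identifying code is decidable, γ^ID(G) exists and is at most |C'| + Δ − 1.
module Submission where

open import Defs
open import Data.Nat using (ℕ; _+_; _∸_; _≤_)
open import Data.Fin using (Fin)
open import Data.Product using (_×_; ∃-syntax)

open import Data.Bool.Base using (T; true; false)
open import Data.Empty using (⊥-elim)
open import Data.Fin.Base using (zero; suc; toℕ; fromℕ<; _↑ˡ_; _↑ʳ_; splitAt; punchIn)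
import Data.Fin.Properties as Fin
open import Data.Fin.Subset using (Subset; _∈_; ∣_∣; ⊤; inside; outside)
import Data.Fin.Subset.Properties as Subset
open import Data.Nat.Base using (zero; suc; _<_; s≤s; z≤n)
open import Data.Nat.Induction using (<-rec)
open import Data.Nat.Properties using (_≟_; ≮⇒≥; +-∸-assoc)
open import Data.Product using (_,_; map₂)
open import Data.Sum using (inj₁; inj₂)
open import Data.Unit using (tt)
open import Data.Vec.Base using ([]; _∷_; _++_)
open import Data.Vec.Properties using (lookup⇒[]=; []=⇒lookup; lookup-++ˡ; lookup-++ʳ; lookup-replicate)
open import Function.Base using (_∘_)
open import Function.Bundles using (_⇔_; mk⇔; Equivalence)
import Function.Properties.Equivalence as ⇔
open import Relation.Binary.PropositionalEquality using (_≡_; _≢_; refl; sym; trans; cong; cong₂; subst)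
open import Relation.Nullary using (¬_; Dec; yes; no; ¬?)
open import Relation.Nullary.Decidable using (T?; _×-dec_; _⊎-dec_; _→-dec_; map′)
open import Relation.Unary using (Pred; Decidable)

least-witness : ∀ {p} {P : Pred ℕ p} → Decidable P →
                ∀ m → P m → ∃[ k ] (P k × (∀ i → P i → k ≤ i))
least-witness {P = P} P? = <-rec _ search
  where
  search : ∀ m → (∀ {j} → j < m → P j → ∃[ k ] (P k × (∀ i → P i → k ≤ i))) →
           P m → ∃[ k ] (P k × (∀ i → P i → k ≤ i))
  search m below pm with Fin.any? (λ (j : Fin m) → P? (toℕ j))
  ... | yes (j , pj) = below (Fin.toℕ<n j) pj
  ... | no none = m , pm , λ i pi → ≮⇒≥ λ i<m →
    none (fromℕ< i<m , subst P (sym (Fin.toℕ-fromℕ< i<m)) pi)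

_⇔-dec_ : ∀ {a b} {A : Set a} {B : Set b} → Dec A → Dec B → Dec (A ⇔ B)
a? ⇔-dec b? = map′ (λ (f , g) → mk⇔ f g) (λ e → Equivalence.to e , Equivalence.from e)
                   ((a? →-dec b?) ×-dec (b? →-dec a?))

∈N[]? : (G : Graph) → ∀ x u → Dec (_∈N[_] {G} x u)
∈N[]? G x u = (x Fin.≟ u) ⊎-dec T? (adj G u x)

IsIDCode? : (G : Graph) → Decidable (IsIDCode G)
IsIDCode? G C =
  Fin.all? (λ v → Fin.any? (λ x → (x Subset.∈? C) ×-dec ∈N[]? G x v)) ×-dec
  Fin.all? (λ u → Fin.all? (λ w → ¬? (u Fin.≟ w) →-dec
    ¬? (Fin.all? (λ x → (x Subset.∈? C) →-dec (∈N[]? G x u ⇔-dec ∈N[]? G x w)))))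

IsIDCode⇒Identifiable : (G : Graph) {C : Subset (n G)} → IsIDCode G C → Identifiable G
IsIDCode⇒Identifiable G (_ , separating) u w u≢w same = separating u w u≢w (λ x _ → same x)

Identifiable⇒IsIDCode-⊤ : (G : Graph) → Identifiable G → IsIDCode G ⊤
Identifiable⇒IsIDCode-⊤ G identifiable =
  (λ v → v , Subset.∈⊤ , inj₁ refl) ,
  λ u w u≢w same → identifiable u w u≢w (λ x → same x Subset.∈⊤)

gammaID≤∣code∣ : (G : Graph) {C : Subset (n G)} → IsIDCode G C →
                 ∃[ k ] (IsGammaID G k × k ≤ ∣ C ∣)
gammaID≤∣code∣ G {C} code =
  let k , hasCode-k , least = least-witness HasCodeOfSize? ∣ C ∣ (C , code , refl)
  in k , (hasCode-k , λ D d → least ∣ D ∣ (D , d , refl)) , least ∣ C ∣ (C , code , refl)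
  where
  HasCodeOfSize : ℕ → Set
  HasCodeOfSize j = ∃[ D ] (IsIDCode G D × ∣ D ∣ ≡ j)
  HasCodeOfSize? : Decidable HasCodeOfSize
  HasCodeOfSize? j = Subset.anySubset? (λ D → IsIDCode? G D ×-dec (∣ D ∣ ≟ j))

∣p++q∣≡∣p∣+∣q∣ : ∀ {m k} (p : Subset m) (q : Subset k) → ∣ p ++ q ∣ ≡ ∣ p ∣ + ∣ q ∣
∣p++q∣≡∣p∣+∣q∣ []            q = refl
∣p++q∣≡∣p∣+∣q∣ (inside ∷ p)  q = cong suc (∣p++q∣≡∣p∣+∣q∣ p q)
∣p++q∣≡∣p∣+∣q∣ (outside ∷ p) q = ∣p++q∣≡∣p∣+∣q∣ p q

module StarAttachment (G' : Graph) (v : Fin (n G')) (d : ℕ) where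

  Δ : ℕ
  Δ = 3 + d

  G : Graph
  G = attachStar G' v Δ

  _∈N'_ : Fin (n G') → Fin (n G') → Set
  x ∈N' u = _∈N[_] {G'} x u

  _∈N_ : Fin (n G) → Fin (n G) → Set
  x ∈N u = _∈N[_] {G} x u

  old : Fin (n G') → Fin (n G)
  old i = i ↑ˡ Δ

  centre : Fin (n G)
  centre = n G' ↑ʳ zero

  leaf : Fin (2 + d) → Fin (n G)
  leaf l = n G' ↑ʳ suc l

  data View : Fin (n G) → Set where
    isOld    : ∀ i → View (old i)
    isCentre : View centre
    isLeaf   : ∀ l → View (leaf l)

  view : ∀ x → View x
  view x with splitAt (n G') x in eq
  ... | inj₁ i       = subst View (Fin.splitAt⁻¹-↑ˡ eq) (isOld i)
  ... | inj₂ zero    = subst View (Fin.splitAt⁻¹-↑ʳ eq) isCentre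
  ... | inj₂ (suc l) = subst View (Fin.splitAt⁻¹-↑ʳ eq) (isLeaf l)

  private
    adjOn : ∀ {x y a b} → splitAt (n G') x ≡ a → splitAt (n G') y ≡ b →
            adj G x y ≡ starAdj (n G') v Δ a b (adj G')
    adjOn = cong₂ (λ a b → starAdj (n G') v Δ a b (adj G'))

    split-old : ∀ i → splitAt (n G') (old i) ≡ inj₁ i
    split-old i = Fin.splitAt-↑ˡ (n G') i Δ

    split-new : ∀ j → splitAt (n G') (n G' ↑ʳ j) ≡ inj₂ j
    split-new = Fin.splitAt-↑ʳ (n G') Δ

  adj-old-old : ∀ i j → adj G (old i) (old j) ≡ adj G' i j
  adj-old-old i j = adjOn (split-old i) (split-old j)

  adj-old-leaf : ∀ i l → adj G (old i) (leaf l) ≡ false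
  adj-old-leaf i l = adjOn (split-old i) (split-new (suc l))

  adj-centre-leaf : ∀ l → adj G centre (leaf l) ≡ true
  adj-centre-leaf l = adjOn (split-new zero) (split-new (suc l))

  adj-leaf-leaf : ∀ l l' → adj G (leaf l) (leaf l') ≡ false
  adj-leaf-leaf l l' = adjOn (split-new (suc l)) (split-new (suc l'))

  old≢leaf : ∀ i l → old i ≢ leaf l
  old≢leaf i l eq
    with trans (sym (split-old i)) (trans (cong (splitAt (n G')) eq) (split-new (suc l)))
  ... | ()

  ∈N-old : ∀ y u → (old y ∈N old u) ⇔ (y ∈N' u)
  ∈N-old y u = mk⇔ to from
    where
    to : old y ∈N old u → y ∈N' u
    to (inj₁ eq) = inj₁ (Fin.↑ˡ-injective Δ y u eq)
    to (inj₂ t)  = inj₂ (subst T (adj-old-old u y) t)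
    from : y ∈N' u → old y ∈N old u
    from (inj₁ refl) = inj₁ refl
    from (inj₂ t)    = inj₂ (subst T (sym (adj-old-old u y)) t)

  leaf∈N-leaf : ∀ l → leaf l ∈N leaf l
  leaf∈N-leaf l = inj₁ refl

  leaf∈N-centre : ∀ l → leaf l ∈N centre
  leaf∈N-centre l = inj₂ (subst T (sym (adj-centre-leaf l)) tt)

  leaf∉N-old : ∀ l i → ¬ leaf l ∈N old i
  leaf∉N-old l i (inj₁ eq) = old≢leaf i l (sym eq)
  leaf∉N-old l i (inj₂ t)  = subst T (adj-old-leaf i l) t

  leaf∉N-leaf : ∀ {l l'} → l ≢ l' → ¬ leaf l ∈N leaf l'
  leaf∉N-leaf l≢l' (inj₁ eq) = l≢l' (Fin.suc-injective (Fin.↑ʳ-injective (n G') _ _ eq))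
  leaf∉N-leaf {l} {l'} _ (inj₂ t) = subst T (adj-leaf-leaf l' l) t

  Separates : Fin (n G) → Fin (n G) → Fin (n G) → Set
  Separates x u w = ¬ (x ∈N u ⇔ x ∈N w)

  separates : ∀ {x u w} → x ∈N u → ¬ x ∈N w → Separates x u w
  separates x∈Nu x∉Nw same = x∉Nw (Equivalence.to same x∈Nu)

  Separates-sym : ∀ {x u w} → Separates x u w → Separates x w u
  Separates-sym separate same = separate (⇔.sym same)

  -- The only use of Δ ≥ 3: leaf l has a sibling, punchIn l zero.
  centre-separated : ∀ {w} → View w → centre ≢ w → ∃[ l ] Separates (leaf l) centre w
  centre-separated (isOld i)  _   = zero , separates (leaf∈N-centre zero) (leaf∉N-old zero i)
  centre-separated isCentre   c≢c = ⊥-elim (c≢c refl)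
  centre-separated (isLeaf l) _   =
    punchIn l zero , separates (leaf∈N-centre _) (leaf∉N-leaf (Fin.punchInᵢ≢i l zero))

  leaf-separated : ∀ l {w} → View w → leaf l ≢ w → ∃[ l' ] Separates (leaf l') (leaf l) w
  leaf-separated l (isOld i)   _   = l , separates (leaf∈N-leaf l) (leaf∉N-old l i)
  leaf-separated l isCentre    l≢c = map₂ Separates-sym (centre-separated (isLeaf l) (l≢c ∘ sym))
  leaf-separated l (isLeaf l') l≢l' = l , separates (leaf∈N-leaf l) (leaf∉N-leaf (l≢l' ∘ cong leaf))

  extend : Subset (n G') → Subset (n G)
  extend C' = C' ++ (outside ∷ ⊤)

  ∣extend∣ : ∀ C' → ∣ extend C' ∣ ≡ ∣ C' ∣ + (2 + d)
  ∣extend∣ C' = trans (∣p++q∣≡∣p∣+∣q∣ C' _) (cong (∣ C' ∣ +_) (Subset.∣⊤∣≡n (2 + d)))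

  old∈extend : ∀ {C' y} → y ∈ C' → old y ∈ extend C'
  old∈extend {C'} {y} y∈C' =
    lookup⇒[]= (old y) (extend C') (trans (lookup-++ˡ C' _ y) ([]=⇒lookup y∈C'))

  leaf∈extend : ∀ C' l → leaf l ∈ extend C'
  leaf∈extend C' l =
    lookup⇒[]= (leaf l) (extend C') (trans (lookup-++ʳ C' _ (suc l)) (lookup-replicate l inside))

  extend-IsIDCode : ∀ {C'} → IsIDCode G' C' → IsIDCode G (extend C')
  extend-IsIDCode {C'} (dominating , separating) =
    (λ u → dominated (view u)) , (λ u w → separated (view u) (view w))
    where
    dominated : ∀ {u} → View u → ∃[ x ] (x ∈ extend C' × x ∈N u)
    dominated (isOld i) with dominating i
    ... | y , y∈C' , y∈N'i = old y , old∈extend y∈C' , Equivalence.from (∈N-old y i) y∈N'i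
    dominated isCentre     = leaf zero , leaf∈extend C' zero , leaf∈N-centre zero
    dominated (isLeaf l)   = leaf l , leaf∈extend C' l , leaf∈N-leaf l

    Distinguished : Fin (n G) → Fin (n G) → Set
    Distinguished u w = ¬ (∀ x → x ∈ extend C' → x ∈N u ⇔ x ∈N w)

    by-leaf : ∀ {u w} → ∃[ l ] Separates (leaf l) u w → Distinguished u w
    by-leaf (l , separate) same = separate (same (leaf l) (leaf∈extend C' l))

    separated : ∀ {u w} → View u → View w → u ≢ w → Distinguished u w
    separated (isOld i) (isOld j)  i≢j same = separating i j (i≢j ∘ cong old) λ y y∈C' →
      ⇔.trans (⇔.sym (∈N-old y i)) (⇔.trans (same (old y) (old∈extend y∈C')) (∈N-old y j))
    separated (isOld i) isCentre   i≢c =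
      by-leaf (map₂ Separates-sym (centre-separated (isOld i) (i≢c ∘ sym)))
    separated (isOld i) (isLeaf l) i≢l =
      by-leaf (map₂ Separates-sym (leaf-separated l (isOld i) (i≢l ∘ sym)))
    separated isCentre   w c≢w = by-leaf (centre-separated w c≢w)
    separated (isLeaf l) w l≢w = by-leaf (leaf-separated l w l≢w)

lemma4p2 : (G' : Graph) → IsSimple G' → Identifiable G' →
    (v : Fin (n G')) → (Δ : ℕ) → 3 ≤ Δ →
    Identifiable (attachStar G' v Δ) ×
    (∀ k' → IsGammaID G' k' →
      ∃[ k ] (IsGammaID (attachStar G' v Δ) k × k ≤ k' + Δ ∸ 1))
lemma4p2 G' _ identifiable v (suc (suc (suc d))) (s≤s (s≤s (s≤s z≤n))) =
  IsIDCode⇒Identifiable G (extend-IsIDCode (Identifiable⇒IsIDCode-⊤ G' identifiable)) ,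
  λ { k' ((C' , code , refl) , _) → bound C' code }
  where
  open StarAttachment G' v d

  bound : ∀ C' → IsIDCode G' C' → ∃[ k ] (IsGammaID G k × k ≤ ∣ C' ∣ + Δ ∸ 1)
  bound C' code =
    let k , gammaID , k≤∣extend∣ = gammaID≤∣code∣ G (extend-IsIDCode code)
    in k , gammaID , subst (k ≤_) ∣extend∣≡∣C'∣+Δ∸1 k≤∣extend∣
    where
    ∣extend∣≡∣C'∣+Δ∸1 : ∣ extend C' ∣ ≡ ∣ C' ∣ + Δ ∸ 1
    ∣extend∣≡∣C'∣+Δ∸1 = trans (∣extend∣ C') (sym (+-∸-assoc ∣ C' ∣ (s≤s z≤n)))
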